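{- Let $k \geq 4$ be an even integer and let $u,g,\lambda$ be positive integers. If $(K_u \times K_g)(\lambda)$ has a $k$-ARCS, then (i) $u \geq 3$ and $g \geq 2$; (ii) $g(u-1) \equiv 0 \pmod{k}$; (iii) $\lambda(g-1) \equiv 0 \pmod{2}$.
   Context: For graphs $G,H$, the tensor product $G \times H$ has vertex set $V(G)\times V(H)$, with $(g_1,h_1)$ adjacent to $(g_2,h_2)$ iff $g_1g_2 \in E(G)$ and $h_1h_2 \in E(H)$. For a graph $G$ and positive integer $\lambda$, $G(\lambda)$ is the multigraph obtained by replacing each edge of $G$ by $\lambda$ parallel edges. $K_n$ is the complete graph on $n$ vertices. The graph $(K_u \times K_g)(\lambda)$ is regarded as a $u$-partite multigraph with partite sets $V_i = \{i\} \times V(K_g)$, $i=1,\dots,u$ (each of size $g$). A partial $C_k$-factor of $(K_u \times K_g)(\lambda)$ is a subgraph which, for some $i$, is a spanning subgraph of $(K_u \times K_g)(\lambda)\setminus V_i$ all of whose components are cycles of length $k$. A $k$-ARCS (almost resolvable $k$-cycle system) of $(K_u \times K_g)(\lambda)$ is a partition of its edge multiset into partial $C_k$-factors. -}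

module Defs where

open import Data.Nat using (ℕ; zero; suc; _+_)
open import Data.Fin using (Fin)
import Data.Fin.Properties as FinP
open import Data.Product using (_×_; _,_; proj₁; proj₂)
open import Data.Product.Properties using (≡-dec)
open import Data.Sum using (_⊎_)
open import Data.List using (List; []; _∷_; _++_; [_]; zip; length; map)
open import Data.Nat.ListAction using (sum)
open import Data.List.Relation.Unary.All using (All)
open import Data.List.Relation.Unary.Unique.Propositional using (Unique)
open import Relation.Nullary using (Dec; yes; no; ¬_)
open import Relation.Nullary.Decidable using (_×-dec_; _⊎-dec_)
open import Relation.Binary.PropositionalEquality using (_≡_; _≢_)
import Data.List.Membership.DecPropositional as DecMem

count : {A : Set} {P : A → Set} → ((x : A) → Dec (P x)) → List A → ℕ
count P? [] = 0
count P? (x ∷ xs) with P? x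
... | yes _ = suc (count P? xs)
... | no  _ = count P? xs

-- vertices of K_u × K_g : (i , a) with i the part index, a ∈ V(K_g)
Vtx : ℕ → ℕ → Set
Vtx u g = Fin u × Fin g

_≟V_ : {u g : ℕ} → (x y : Vtx u g) → Dec (x ≡ y)
_≟V_ = ≡-dec FinP._≟_ FinP._≟_

-- adjacency in the tensor product K_u × K_g (each such pair carries λ parallel edges
-- in (K_u × K_g)(λ))
Adj : {u g : ℕ} → Vtx u g → Vtx u g → Set
Adj (i , a) (j , b) = (i ≢ j) × (a ≢ b)

-- a cycle is given by its cyclic vertex sequence v₀ … v_{k-1}; its edges are
-- v₀v₁, …, v_{k-2}v_{k-1}, v_{k-1}v₀
rotate : {A : Set} → List A → List A
rotate [] = []
rotate (x ∷ xs) = xs ++ [ x ]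

cycleEdges : {A : Set} → List A → List (A × A)
cycleEdges vs = zip vs (rotate vs)

record IsKCycle {u g : ℕ} (k : ℕ) (vs : List (Vtx u g)) : Set where
  field
    len      : length vs ≡ k
    distinct : Unique vs
    adjacent : All (λ e → Adj (proj₁ e) (proj₂ e)) (cycleEdges vs)

SameEdge : {u g : ℕ} → Vtx u g → Vtx u g → Vtx u g × Vtx u g → Set
SameEdge x y e = ((proj₁ e ≡ x) × (proj₂ e ≡ y)) ⊎ ((proj₁ e ≡ y) × (proj₂ e ≡ x))

sameEdge? : {u g : ℕ} (x y : Vtx u g) (e : Vtx u g × Vtx u g) → Dec (SameEdge x y e)
sameEdge? x y e = ((proj₁ e ≟V x) ×-dec (proj₂ e ≟V y)) ⊎-dec ((proj₁ e ≟V y) ×-dec (proj₂ e ≟V x))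

edgeMult : {u g : ℕ} → Vtx u g → Vtx u g → List (Vtx u g) → ℕ
edgeMult x y vs = count (sameEdge? x y) (cycleEdges vs)

visits : {u g : ℕ} → Vtx u g → List (List (Vtx u g)) → ℕ
visits v cs = count (λ c → DecMem._∈?_ _≟V_ v c) cs

record PartialCkFactor (k u g : ℕ) : Set where
  field
    hole        : Fin u
    cycles      : List (List (Vtx u g))
    areCycles   : All (IsKCycle k) cycles
    nonNull     : cycles ≢ []
    missesHole  : (v : Vtx u g) → proj₁ v ≡ hole → visits v cycles ≡ 0
    coversRest  : (v : Vtx u g) → proj₁ v ≢ hole → visits v cycles ≡ 1

factorEdgeMult : {k u g : ℕ} → Vtx u g → Vtx u g → PartialCkFactor k u g → ℕ
factorEdgeMult x y F = sum (map (edgeMult x y) (PartialCkFactor.cycles F))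

record ARCS (k u g lam : ℕ) : Set where
  field
    factors   : List (PartialCkFactor k u g)
    nonEmpty  : factors ≢ []
    partition : (x y : Vtx u g) → Adj x y → sum (map (factorEdgeMult x y) factors) ≡ lam

-- (i) Two consecutive vertices of a cycle of a partial factor lie in distinct parts, both
-- different from the missed part, and have distinct second coordinates; so u ≥ 3 and g ≥ 2.
-- (ii) A single partial factor covers the g(u - 1) vertices outside its missed part by
-- vertex-disjoint k-cycles.
-- (iii) A vertex of V_i has degree (u - 1)(g - 1)λ, and each factor not missing V_i contributes
-- exactly 2 to it; hence the number c_i of such factors satisfies 2 c_i = (u - 1)(g - 1)λ and
-- does not depend on i, and neither does the number h_i = N - c_i of factors missing V_i.
-- Every factor misses exactly one part, so N = u h, c = (u - 1) h, and cancelling u - 1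
-- gives (g - 1)λ = 2h.

module Submission where

open import Defs
open import Data.Fin.Base using (Fin; zero; suc; fromℕ<)
open import Data.Fin.Properties using (_≟_; punchOut-injective)
import Data.Fin.Properties as Fin
open import Data.List.Base using (List; []; _∷_; _++_; [_]; zip; length; map; allFin)
open import Data.List.Properties using (map-cong; map-cong-local; map-tabulate; length-tabulate; length-++)
open import Data.List.Membership.Propositional using (_∈_)
import Data.List.Membership.DecPropositional as DecMem
open import Data.List.Relation.Unary.All as All using (All; []; _∷_)
open import Data.List.Relation.Unary.Any using (here; there)
open import Data.List.Relation.Unary.AllPairs using ([]; _∷_)
open import Data.List.Relation.Unary.Unique.Propositional using (Unique)
open import Data.List.Relation.Binary.Permutation.Propositional using (_↭_; ↭-refl)
open import Data.List.Relation.Binary.Permutation.Propositional.Properties using (++-comm; map⁺)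
open import Data.Nat.Base using (ℕ; zero; suc; _+_; _*_; _∸_; _≤_; _≥_; z≤n; s≤s; >-nonZero)
open import Data.Nat.Properties
  using ( suc-injective; ≤-trans; n≤1+n; m<n⇒0<n∸m; m+n∸m≡n; +-comm; *-comm; +-identityʳ; *-identityˡ
        ; *-identityʳ; *-zeroʳ; *-distribˡ-+; *-distribʳ-+; *-distribʳ-∸; +-cancelʳ-≡; *-cancelˡ-≡
        ; +-commutativeSemigroup; *-commutativeSemigroup )
open import Data.Nat.Divisibility using (_∣_; divides)
open import Data.Nat.ListAction using (sum)
open import Data.Nat.ListAction.Properties using (sum-↭)
open import Data.Product.Base using (Σ; _×_; _,_; proj₁; proj₂)
open import Data.Sum.Base using (inj₁; inj₂)
open import Function.Base using (_∘_; id)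
open import Relation.Nullary using (Dec; yes; no; ¬_; ¬?; contradiction)
open import Relation.Binary.PropositionalEquality
  using (_≡_; _≢_; refl; sym; trans; cong; cong₂; subst; subst₂; _≗_; module ≡-Reasoning)
open import Algebra.Properties.CommutativeSemigroup +-commutativeSemigroup
  using () renaming (interchange to +-interchange)
open import Algebra.Properties.CommutativeSemigroup *-commutativeSemigroup
  using () renaming (x∙yz≈y∙xz to *-left-comm)

open ≡-Reasoning

χ : {P : Set} → Dec P → ℕ
χ (yes _) = 1
χ (no _)  = 0

χ-yes : {P : Set} (d : Dec P) → P → χ d ≡ 1
χ-yes (yes _) p = refl
χ-yes (no ¬p) p = contradiction p ¬p

χ-no : {P : Set} (d : Dec P) → ¬ P → χ d ≡ 0
χ-no (yes p) ¬p = contradiction p ¬p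
χ-no (no _)  ¬p = refl

χ+χ¬≡1 : {P : Set} (d : Dec P) → χ d + χ (¬? d) ≡ 1
χ+χ¬≡1 (yes _) = refl
χ+χ¬≡1 (no _)  = refl

χ-cong : {P Q : Set} → (P → Q) → (Q → P) → (d : Dec P) (e : Dec Q) → χ d ≡ χ e
χ-cong f g (yes p) e = sym (χ-yes e (f p))
χ-cong f g (no ¬p) e = sym (χ-no e (¬p ∘ g))

∑ : {A : Set} → List A → (A → ℕ) → ℕ
∑ xs f = sum (map f xs)

count≡∑χ : {A : Set} {P : A → Set} (P? : (x : A) → Dec (P x)) (xs : List A) →
  count P? xs ≡ ∑ xs (χ ∘ P?)
count≡∑χ P? [] = refl
count≡∑χ P? (x ∷ xs) with P? x
... | yes _ = cong suc (count≡∑χ P? xs)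
... | no _  = count≡∑χ P? xs

module _ {A : Set} where

  ∑-cong : {f h : A → ℕ} → f ≗ h → (xs : List A) → ∑ xs f ≡ ∑ xs h
  ∑-cong f≗h xs = cong sum (map-cong f≗h xs)

  ∑-cong-local : {f h : A → ℕ} {xs : List A} → All (λ x → f x ≡ h x) xs → ∑ xs f ≡ ∑ xs h
  ∑-cong-local eqs = cong sum (map-cong-local eqs)

  ∑-zero : {f : A → ℕ} → f ≗ (λ _ → 0) → (xs : List A) → ∑ xs f ≡ 0
  ∑-zero f≗0 []       = refl
  ∑-zero f≗0 (x ∷ xs) = cong₂ _+_ (f≗0 x) (∑-zero f≗0 xs)

  ∑-const : (c : ℕ) (xs : List A) → ∑ xs (λ _ → c) ≡ length xs * c
  ∑-const c []       = refl
  ∑-const c (x ∷ xs) = cong (c +_) (∑-const c xs)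

  ∑-↭ : (f : A → ℕ) {xs ys : List A} → xs ↭ ys → ∑ xs f ≡ ∑ ys f
  ∑-↭ f xs↭ys = sum-↭ (map⁺ f xs↭ys)

  ∑-+ : (f h : A → ℕ) (xs : List A) → ∑ xs (λ x → f x + h x) ≡ ∑ xs f + ∑ xs h
  ∑-+ f h []       = refl
  ∑-+ f h (x ∷ xs) = trans (cong (f x + h x +_) (∑-+ f h xs)) (+-interchange (f x) (h x) _ _)

  ∑-*ˡ : (c : ℕ) (f : A → ℕ) (xs : List A) → ∑ xs (λ x → c * f x) ≡ c * ∑ xs f
  ∑-*ˡ c f []       = sym (*-zeroʳ c)
  ∑-*ˡ c f (x ∷ xs) = trans (cong (c * f x +_) (∑-*ˡ c f xs)) (sym (*-distribˡ-+ c (f x) _))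

  ∑-*ʳ : (c : ℕ) (f : A → ℕ) (xs : List A) → ∑ xs (λ x → f x * c) ≡ ∑ xs f * c
  ∑-*ʳ c f []       = refl
  ∑-*ʳ c f (x ∷ xs) = trans (cong (f x * c +_) (∑-*ʳ c f xs)) (sym (*-distribʳ-+ c (f x) _))

∑-comm : {A B : Set} (h : A → B → ℕ) (xs : List A) (ys : List B) →
  ∑ xs (λ x → ∑ ys (h x)) ≡ ∑ ys (λ y → ∑ xs (λ x → h x y))
∑-comm h []       ys = sym (∑-zero (λ _ → refl) ys)
∑-comm h (x ∷ xs) ys =
  trans (cong (∑ ys (h x) +_) (∑-comm h xs ys)) (sym (∑-+ (h x) (λ y → ∑ xs (λ x → h x y)) ys))

∑-zip : {A B : Set} (f : A → ℕ) (h : B → ℕ) (xs : List A) (ys : List B) → length xs ≡ length ys →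
  ∑ (zip xs ys) (λ e → f (proj₁ e) + h (proj₂ e)) ≡ ∑ xs f + ∑ ys h
∑-zip f h []       []       _  = refl
∑-zip f h (x ∷ xs) (y ∷ ys) eq =
  trans (cong (f x + h y +_) (∑-zip f h xs ys (suc-injective eq))) (+-interchange (f x) (h y) _ _)

rotate-↭ : {A : Set} (xs : List A) → rotate xs ↭ xs
rotate-↭ []       = ↭-refl
rotate-↭ (x ∷ xs) = ++-comm xs [ x ]

length-rotate : {A : Set} (xs : List A) → length (rotate xs) ≡ length xs
length-rotate []       = refl
length-rotate (x ∷ xs) = trans (length-++ xs) (+-comm (length xs) 1)

nonempty-∈ : {A : Set} {xs : List A} → xs ≢ [] → Σ A (_∈ xs)
nonempty-∈ {xs = []}    xs≢[] = contradiction refl xs≢[]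
nonempty-∈ {xs = x ∷ _} _     = x , here refl

∑-allFin-const : (n c : ℕ) → ∑ (allFin n) (λ _ → c) ≡ n * c
∑-allFin-const n c = trans (∑-const c (allFin n)) (cong (_* c) (length-tabulate {n = n} id))

∑-allFin-suc : {n : ℕ} (f : Fin (suc n) → ℕ) → ∑ (allFin (suc n)) f ≡ f zero + ∑ (allFin n) (f ∘ suc)
∑-allFin-suc f =
  cong (f zero +_) (cong sum (trans (map-tabulate suc f) (sym (map-tabulate id (f ∘ suc)))))

∑-allFin-δ : {n : ℕ} (f : Fin n → ℕ) (j : Fin n) → (∀ i → i ≢ j → f i ≡ 0) → ∑ (allFin n) f ≡ f j
∑-allFin-δ {suc n} f zero    off = begin
  ∑ (allFin (suc n)) f              ≡⟨ ∑-allFin-suc f ⟩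
  f zero + ∑ (allFin n) (f ∘ suc)   ≡⟨ cong (f zero +_) (∑-zero (λ i → off (suc i) (λ ())) (allFin n)) ⟩
  f zero + 0                        ≡⟨ +-identityʳ (f zero) ⟩
  f zero                            ∎
∑-allFin-δ {suc n} f (suc j) off = begin
  ∑ (allFin (suc n)) f              ≡⟨ ∑-allFin-suc f ⟩
  f zero + ∑ (allFin n) (f ∘ suc)   ≡⟨ cong₂ _+_ (off zero (λ ())) (∑-allFin-δ (f ∘ suc) j off∘suc) ⟩
  f (suc j)                         ∎
  where
  off∘suc : ∀ i → i ≢ j → f (suc i) ≡ 0
  off∘suc i i≢j = off (suc i) (i≢j ∘ Fin.suc-injective)

∑-allFin-χ≟ : {n : ℕ} (j : Fin n) → ∑ (allFin n) (λ i → χ (i ≟ j)) ≡ 1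
∑-allFin-χ≟ j = trans (∑-allFin-δ (λ i → χ (i ≟ j)) j (λ i → χ-no (i ≟ j))) (χ-yes (j ≟ j) refl)

∑-allFin-others : {n : ℕ} (j : Fin n) → ∑ (allFin n) (λ i → χ (¬? (i ≟ j))) ≡ n ∸ 1
∑-allFin-others {n} j = cong (_∸ 1) (begin
  1 + ∑ (allFin n) (λ i → χ (¬? (i ≟ j)))
    ≡⟨ cong (_+ ∑ (allFin n) (λ i → χ (¬? (i ≟ j)))) (sym (∑-allFin-χ≟ j)) ⟩
  ∑ (allFin n) (λ i → χ (i ≟ j)) + ∑ (allFin n) (λ i → χ (¬? (i ≟ j)))
    ≡⟨ sym (∑-+ _ _ (allFin n)) ⟩
  ∑ (allFin n) (λ i → χ (i ≟ j) + χ (¬? (i ≟ j)))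
    ≡⟨ ∑-cong (λ i → χ+χ¬≡1 (i ≟ j)) (allFin n) ⟩
  ∑ (allFin n) (λ _ → 1)
    ≡⟨ ∑-allFin-const n 1 ⟩
  n * 1
    ≡⟨ *-identityʳ n ⟩
  n ∎)

module _ {u g : ℕ} where

  ∑V : (Vtx u g → ℕ) → ℕ
  ∑V f = ∑ (allFin u) (λ i → ∑ (allFin g) (λ a → f (i , a)))

  ∑V-cong : {f h : Vtx u g → ℕ} → f ≗ h → ∑V f ≡ ∑V h
  ∑V-cong f≗h = ∑-cong (λ i → ∑-cong (λ a → f≗h (i , a)) (allFin g)) (allFin u)

  ∑V-comm : {B : Set} (h : Vtx u g → B → ℕ) (ys : List B) →
    ∑V (λ v → ∑ ys (h v)) ≡ ∑ ys (λ y → ∑V (λ v → h v y))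
  ∑V-comm h ys = begin
    ∑V (λ v → ∑ ys (h v))
      ≡⟨ ∑-cong (λ i → ∑-comm (λ a → h (i , a)) (allFin g) ys) (allFin u) ⟩
    ∑ (allFin u) (λ i → ∑ ys (λ y → ∑ (allFin g) (λ a → h (i , a) y)))
      ≡⟨ ∑-comm (λ i y → ∑ (allFin g) (λ a → h (i , a) y)) (allFin u) ys ⟩
    ∑ ys (λ y → ∑V (λ v → h v y)) ∎

  ∑V-δ : (f : Vtx u g → ℕ) (x : Vtx u g) → (∀ y → y ≢ x → f y ≡ 0) → ∑V f ≡ f x
  ∑V-δ f (j , b) off =
    trans (∑-allFin-δ _ j (λ i i≢j → ∑-zero (λ a → off (i , a) (i≢j ∘ cong proj₁)) (allFin g)))
          (∑-allFin-δ _ b (λ a a≢b → off (j , a) (a≢b ∘ cong proj₂)))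

  ∑V-product : (f : Fin u → ℕ) (h : Fin g → ℕ) →
    ∑V (λ v → f (proj₁ v) * h (proj₂ v)) ≡ ∑ (allFin u) f * ∑ (allFin g) h
  ∑V-product f h =
    trans (∑-cong (λ i → ∑-*ˡ (f i) h (allFin g)) (allFin u)) (∑-*ʳ (∑ (allFin g) h) f (allFin u))

  infix 4 _∈V?_
  _∈V?_ : (v : Vtx u g) (c : List (Vtx u g)) → Dec (v ∈ c)
  _∈V?_ = DecMem._∈?_ _≟V_

  ∑-χ-occurrences : (x : Vtx u g) {c : List (Vtx u g)} → Unique c → ∑ c (λ y → χ (y ≟V x)) ≡ χ (x ∈V? c)
  ∑-χ-occurrences x [] = refl
  ∑-χ-occurrences x {y ∷ ys} (y∉ys ∷ unique-ys) with y ≟V x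
  ... | yes refl = begin
    suc (∑ ys (λ z → χ (z ≟V x)))
      ≡⟨ cong suc (∑-cong-local (All.map (λ x≢z → χ-no (_ ≟V x) (x≢z ∘ sym)) y∉ys)) ⟩
    suc (∑ ys (λ _ → 0))   ≡⟨ cong suc (∑-zero (λ _ → refl) ys) ⟩
    1                      ≡⟨ sym (χ-yes (x ∈V? x ∷ ys) (here refl)) ⟩
    χ (x ∈V? x ∷ ys)       ∎
  ... | no y≢x = trans (∑-χ-occurrences x unique-ys)
                       (χ-cong there (λ { (here x≡y) → contradiction (sym x≡y) y≢x ; (there x∈ys) → x∈ys })
                               (x ∈V? ys) (x ∈V? y ∷ ys))

  ∑V-χ-∈ : {c : List (Vtx u g)} → Unique c → ∑V (λ v → χ (v ∈V? c)) ≡ length c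
  ∑V-χ-∈ {c} unique-c = begin
    ∑V (λ v → χ (v ∈V? c))                      ≡⟨ ∑V-cong (λ v → sym (∑-χ-occurrences v unique-c)) ⟩
    ∑V (λ v → ∑ c (λ y → χ (y ≟V v)))           ≡⟨ ∑V-comm (λ v y → χ (y ≟V v)) c ⟩
    ∑ c (λ y → ∑V (λ v → χ (y ≟V v)))           ≡⟨ ∑-cong (λ y → ∑V-δ _ y (λ v v≢y → χ-no (y ≟V v) (v≢y ∘ sym))) c ⟩
    ∑ c (λ y → χ (y ≟V y))                      ≡⟨ ∑-cong (λ y → χ-yes (y ≟V y) refl) c ⟩
    ∑ c (λ _ → 1)                               ≡⟨ ∑-const 1 c ⟩
    length c * 1                                ≡⟨ *-identityʳ (length c) ⟩
    length c                                    ∎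

  Adj-sym : {x y : Vtx u g} → Adj x y → Adj y x
  Adj-sym (i≢j , a≢b) = i≢j ∘ sym , a≢b ∘ sym

  Adj-irrefl : {x y : Vtx u g} → Adj x y → x ≢ y
  Adj-irrefl (i≢j , _) = i≢j ∘ cong proj₁

  ∑V-χ-sameEdge : (x p q : Vtx u g) → p ≢ q →
    ∑V (λ y → χ (sameEdge? x y (p , q))) ≡ χ (p ≟V x) + χ (q ≟V x)
  ∑V-χ-sameEdge x p q p≢q with p ≟V x | q ≟V x
  ... | yes p≡x | yes q≡x = contradiction (trans p≡x (sym q≡x)) p≢q
  ... | yes p≡x | no q≢x = trans
    (∑V-δ _ q (λ y y≢q → χ-no _ λ { (inj₁ (_ , q≡y)) → y≢q (sym q≡y) ; (inj₂ (_ , q≡x)) → q≢x q≡x }))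
    (χ-yes _ (inj₁ (p≡x , refl)))
  ... | no p≢x | yes q≡x = trans
    (∑V-δ _ p (λ y y≢p → χ-no _ λ { (inj₁ (p≡x , _)) → p≢x p≡x ; (inj₂ (p≡y , _)) → y≢p (sym p≡y) }))
    (χ-yes _ (inj₂ (refl , q≡x)))
  ... | no p≢x | no q≢x =
    ∑-zero (λ i → ∑-zero (λ a → χ-no _ λ { (inj₁ (p≡x , _)) → p≢x p≡x ; (inj₂ (_ , q≡x)) → q≢x q≡x })
                         (allFin g))
           (allFin u)

  cycle-degree : {k : ℕ} (x : Vtx u g) {c : List (Vtx u g)} → IsKCycle k c →
    ∑V (λ y → edgeMult x y c) ≡ 2 * χ (x ∈V? c)
  cycle-degree x {c} c-cycle = begin
    ∑V (λ y → edgeMult x y c)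
      ≡⟨ ∑V-cong (λ y → count≡∑χ (sameEdge? x y) (cycleEdges c)) ⟩
    ∑V (λ y → ∑ (cycleEdges c) (λ e → χ (sameEdge? x y e)))
      ≡⟨ ∑V-comm (λ y e → χ (sameEdge? x y e)) (cycleEdges c) ⟩
    ∑ (cycleEdges c) (λ e → ∑V (λ y → χ (sameEdge? x y e)))
      ≡⟨ ∑-cong-local (All.map (λ adj → ∑V-χ-sameEdge x _ _ (Adj-irrefl adj)) (IsKCycle.adjacent c-cycle)) ⟩
    ∑ (cycleEdges c) (λ e → occ (proj₁ e) + occ (proj₂ e))
      -- the first endpoints of the edges of c run through c, the second ones through its rotation
      ≡⟨ ∑-zip occ occ c (rotate c) (sym (length-rotate c)) ⟩
    ∑ c occ + ∑ (rotate c) occ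
      ≡⟨ cong (∑ c occ +_) (∑-↭ occ (rotate-↭ c)) ⟩
    ∑ c occ + ∑ c occ
      ≡⟨ cong₂ _+_ occurrences (trans occurrences (sym (*-identityˡ _))) ⟩
    2 * χ (x ∈V? c) ∎
    where
    occ : Vtx u g → ℕ
    occ y = χ (y ≟V x)
    occurrences : ∑ c occ ≡ χ (x ∈V? c)
    occurrences = ∑-χ-occurrences x (IsKCycle.distinct c-cycle)

  edgeMult-nonAdj : {k : ℕ} {x y : Vtx u g} → ¬ Adj x y → {c : List (Vtx u g)} → IsKCycle k c →
    edgeMult x y c ≡ 0
  edgeMult-nonAdj {x = x} {y} ¬adj {c} c-cycle =
    trans (count≡∑χ (sameEdge? x y) (cycleEdges c))
          (trans (∑-cong-local (All.map not-xy (IsKCycle.adjacent c-cycle)))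
                 (∑-zero (λ _ → refl) (cycleEdges c)))
    where
    not-xy : {e : Vtx u g × Vtx u g} → Adj (proj₁ e) (proj₂ e) → χ (sameEdge? x y e) ≡ 0
    not-xy adj = χ-no _ λ
      { (inj₁ (p≡x , q≡y)) → ¬adj (subst₂ Adj p≡x q≡y adj)
      ; (inj₂ (p≡y , q≡x)) → ¬adj (Adj-sym (subst₂ Adj p≡y q≡x adj)) }

  visits-∈ : {v : Vtx u g} {c : List (Vtx u g)} {cs : List (List (Vtx u g))} → c ∈ cs → v ∈ c → visits v cs ≢ 0
  visits-∈ {v} {cs = c′ ∷ _} (here refl) v∈c with v ∈V? c′
  ... | yes _   = λ ()
  ... | no  v∉c = contradiction v∈c v∉c
  visits-∈ {v} {cs = c′ ∷ _} (there c∈cs) v∈c with v ∈V? c′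
  ... | yes _   = λ ()
  ... | no  _   = visits-∈ c∈cs v∈c

two-distinct⇒2≤ : {n : ℕ} {a b : Fin n} → a ≢ b → 2 ≤ n
two-distinct⇒2≤ {suc zero}    {zero} {zero} a≢b = contradiction refl a≢b
two-distinct⇒2≤ {suc (suc n)} _                  = s≤s (s≤s z≤n)

three-distinct⇒3≤ : {n : ℕ} {h a b : Fin n} → h ≢ a → h ≢ b → a ≢ b → 3 ≤ n
three-distinct⇒3≤ {suc n} h≢a h≢b a≢b = s≤s (two-distinct⇒2≤ (a≢b ∘ punchOut-injective h≢a h≢b))

cycle-bounds : {k u g : ℕ} {c : List (Vtx u g)} → 2 ≤ k → IsKCycle k c →
  (hole : Fin u) → (∀ {v} → v ∈ c → proj₁ v ≢ hole) → u ≥ 3 × g ≥ 2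
cycle-bounds {c = []} 2≤k c-cycle _ _ =
  contradiction (subst (2 ≤_) (sym (IsKCycle.len c-cycle)) 2≤k) λ ()
cycle-bounds {c = _ ∷ []} 2≤k c-cycle _ _ =
  contradiction (subst (2 ≤_) (sym (IsKCycle.len c-cycle)) 2≤k) λ { (s≤s ()) }
cycle-bounds {c = _ ∷ _ ∷ _} _ c-cycle hole off-hole with IsKCycle.adjacent c-cycle
... | (i≢j , a≢b) ∷ _ =
  three-distinct⇒3≤ (off-hole (here refl) ∘ sym) (off-hole (there (here refl)) ∘ sym) i≢j ,
  two-distinct⇒2≤ a≢b

module _ {k u g : ℕ} (F : PartialCkFactor k u g) where
  open PartialCkFactor F

  visits≡χ-off-hole : (v : Vtx u g) → visits v cycles ≡ χ (¬? (proj₁ v ≟ hole))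
  visits≡χ-off-hole v with proj₁ v ≟ hole
  ... | yes in-hole = missesHole v in-hole
  ... | no off-hole = coversRest v off-hole

  factor-vertex-count : g * (u ∸ 1) ≡ length cycles * k
  factor-vertex-count = begin
    g * (u ∸ 1)
      ≡⟨ *-comm g (u ∸ 1) ⟩
    (u ∸ 1) * g
      ≡⟨ cong₂ _*_ (sym (∑-allFin-others hole)) (sym (trans (∑-allFin-const g 1) (*-identityʳ g))) ⟩
    ∑ (allFin u) (λ i → χ (¬? (i ≟ hole))) * ∑ (allFin g) (λ _ → 1)
      ≡⟨ sym (∑V-product {u} {g} (λ i → χ (¬? (i ≟ hole))) (λ _ → 1)) ⟩
    ∑V {u} {g} (λ v → χ (¬? (proj₁ v ≟ hole)) * 1)
      ≡⟨ ∑V-cong (λ v → trans (*-identityʳ _) (sym (visits≡χ-off-hole v))) ⟩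
    ∑V (λ v → visits v cycles)
      ≡⟨ ∑V-cong (λ v → count≡∑χ (v ∈V?_) cycles) ⟩
    ∑V (λ v → ∑ cycles (λ c → χ (v ∈V? c)))
      ≡⟨ ∑V-comm (λ v c → χ (v ∈V? c)) cycles ⟩
    ∑ cycles (λ c → ∑V (λ v → χ (v ∈V? c)))
      ≡⟨ ∑-cong-local (All.map (λ c-cycle → trans (∑V-χ-∈ (IsKCycle.distinct c-cycle)) (IsKCycle.len c-cycle))
                               areCycles) ⟩
    ∑ cycles (λ _ → k)
      ≡⟨ ∑-const k cycles ⟩
    length cycles * k ∎

  factor-degree : (x : Vtx u g) → ∑V (λ y → factorEdgeMult x y F) ≡ 2 * χ (¬? (proj₁ x ≟ hole))
  factor-degree x = begin
    ∑V (λ y → ∑ cycles (edgeMult x y))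
      ≡⟨ ∑V-comm (λ y → edgeMult x y) cycles ⟩
    ∑ cycles (λ c → ∑V (λ y → edgeMult x y c))
      ≡⟨ ∑-cong-local (All.map (cycle-degree x) areCycles) ⟩
    ∑ cycles (λ c → 2 * χ (x ∈V? c))
      ≡⟨ ∑-*ˡ 2 (λ c → χ (x ∈V? c)) cycles ⟩
    2 * ∑ cycles (λ c → χ (x ∈V? c))
      ≡⟨ cong (2 *_) (trans (sym (count≡∑χ (x ∈V?_) cycles)) (visits≡χ-off-hole x)) ⟩
    2 * χ (¬? (proj₁ x ≟ hole)) ∎

  factorEdgeMult-nonAdj : {x y : Vtx u g} → ¬ Adj x y → factorEdgeMult x y F ≡ 0
  factorEdgeMult-nonAdj ¬adj =
    trans (∑-cong-local (All.map (edgeMult-nonAdj ¬adj) areCycles)) (∑-zero (λ _ → refl) cycles)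

  factor-bounds : 2 ≤ k → u ≥ 3 × g ≥ 2
  factor-bounds 2≤k = cycle-bounds 2≤k (All.lookup areCycles c∈cycles) hole
    (λ v∈c in-hole → visits-∈ c∈cycles v∈c (missesHole _ in-hole))
    where
    c∈cycles : proj₁ (nonempty-∈ nonNull) ∈ cycles
    c∈cycles = proj₂ (nonempty-∈ nonNull)

module _ {k u g lam : ℕ} (A : ARCS k u g lam) where
  open ARCS A
  open PartialCkFactor using (hole)

  holeCount coverCount : Fin u → ℕ
  holeCount  i = ∑ factors (λ F → χ (i ≟ hole F))
  coverCount i = ∑ factors (λ F → χ (¬? (i ≟ hole F)))

  edge-multiplicity : (i j : Fin u) (a b : Fin g) →
    ∑ factors (factorEdgeMult (i , a) (j , b)) ≡ χ (¬? (j ≟ i)) * (χ (¬? (b ≟ a)) * lam)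
  edge-multiplicity i j a b with j ≟ i | b ≟ a
  ... | no j≢i  | no b≢a  = trans (partition (i , a) (j , b) (j≢i ∘ sym , b≢a ∘ sym))
                                  (sym (trans (*-identityˡ _) (*-identityˡ lam)))
  ... | yes j≡i | _       = ∑-zero (λ F → factorEdgeMult-nonAdj F (λ adj → proj₁ adj (sym j≡i))) factors
  ... | no _    | yes b≡a = ∑-zero (λ F → factorEdgeMult-nonAdj F (λ adj → proj₂ adj (sym b≡a))) factors

  arcs-degree : (x : Vtx u g) → ∑V (λ y → ∑ factors (factorEdgeMult x y)) ≡ (u ∸ 1) * ((g ∸ 1) * lam)
  arcs-degree (i , a) = begin
    ∑V (λ y → ∑ factors (factorEdgeMult (i , a) y))
      ≡⟨ ∑V-cong (λ y → edge-multiplicity i (proj₁ y) a (proj₂ y)) ⟩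
    ∑V (λ y → χ (¬? (proj₁ y ≟ i)) * (χ (¬? (proj₂ y ≟ a)) * lam))
      ≡⟨ ∑V-product (λ j → χ (¬? (j ≟ i))) (λ b → χ (¬? (b ≟ a)) * lam) ⟩
    ∑ (allFin u) (λ j → χ (¬? (j ≟ i))) * ∑ (allFin g) (λ b → χ (¬? (b ≟ a)) * lam)
      ≡⟨ cong₂ _*_ (∑-allFin-others i) (trans (∑-*ʳ lam _ (allFin g)) (cong (_* lam) (∑-allFin-others a))) ⟩
    (u ∸ 1) * ((g ∸ 1) * lam) ∎

  coverCount-degree : Fin g → (i : Fin u) → 2 * coverCount i ≡ (u ∸ 1) * ((g ∸ 1) * lam)
  coverCount-degree a i = begin
    2 * coverCount i
      ≡⟨ sym (∑-*ˡ 2 (λ F → χ (¬? (i ≟ hole F))) factors) ⟩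
    ∑ factors (λ F → 2 * χ (¬? (i ≟ hole F)))
      ≡⟨ sym (∑-cong (λ F → factor-degree F (i , a)) factors) ⟩
    ∑ factors (λ F → ∑V (λ y → factorEdgeMult (i , a) y F))
      ≡⟨ sym (∑V-comm (λ y → factorEdgeMult (i , a) y) factors) ⟩
    ∑V (λ y → ∑ factors (factorEdgeMult (i , a) y))
      ≡⟨ arcs-degree (i , a) ⟩
    (u ∸ 1) * ((g ∸ 1) * lam) ∎

  holeCount+coverCount : (i : Fin u) → holeCount i + coverCount i ≡ length factors
  holeCount+coverCount i = begin
    holeCount i + coverCount i
      ≡⟨ sym (∑-+ (λ F → χ (i ≟ hole F)) (λ F → χ (¬? (i ≟ hole F))) factors) ⟩
    ∑ factors (λ F → χ (i ≟ hole F) + χ (¬? (i ≟ hole F)))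
      ≡⟨ ∑-cong (λ F → χ+χ¬≡1 (i ≟ hole F)) factors ⟩
    ∑ factors (λ _ → 1)
      ≡⟨ ∑-const 1 factors ⟩
    length factors * 1
      ≡⟨ *-identityʳ _ ⟩
    length factors ∎

  ∑-holeCount : ∑ (allFin u) holeCount ≡ length factors
  ∑-holeCount = begin
    ∑ (allFin u) holeCount
      ≡⟨ ∑-comm (λ i F → χ (i ≟ hole F)) (allFin u) factors ⟩
    ∑ factors (λ F → ∑ (allFin u) (λ i → χ (i ≟ hole F)))
      ≡⟨ ∑-cong (λ F → ∑-allFin-χ≟ (hole F)) factors ⟩
    ∑ factors (λ _ → 1)
      ≡⟨ ∑-const 1 factors ⟩
    length factors * 1
      ≡⟨ *-identityʳ _ ⟩
    length factors ∎

  holeCount-uniform : Fin g → (i j : Fin u) → holeCount i ≡ holeCount j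
  holeCount-uniform a i j = +-cancelʳ-≡ (coverCount i) _ _ (begin
    holeCount i + coverCount i   ≡⟨ trans (holeCount+coverCount i) (sym (holeCount+coverCount j)) ⟩
    holeCount j + coverCount j   ≡⟨ cong (holeCount j +_) (sym coverCount-uniform) ⟩
    holeCount j + coverCount i   ∎)
    where
    coverCount-uniform : coverCount i ≡ coverCount j
    coverCount-uniform =
      *-cancelˡ-≡ _ _ 2 (trans (coverCount-degree a i) (sym (coverCount-degree a j)))

  coverCount≡[u∸1]*holeCount : Fin g → (i : Fin u) → coverCount i ≡ (u ∸ 1) * holeCount i
  coverCount≡[u∸1]*holeCount a i = begin
    coverCount i                          ≡⟨ sym (m+n∸m≡n (holeCount i) (coverCount i)) ⟩
    holeCount i + coverCount i ∸ holeCount i   ≡⟨ cong₂ _∸_ factor-count (sym (*-identityˡ (holeCount i))) ⟩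
    u * holeCount i ∸ 1 * holeCount i     ≡⟨ sym (*-distribʳ-∸ (holeCount i) u 1) ⟩
    (u ∸ 1) * holeCount i                 ∎
    where
    factor-count : holeCount i + coverCount i ≡ u * holeCount i
    factor-count = begin
      holeCount i + coverCount i           ≡⟨ holeCount+coverCount i ⟩
      length factors                       ≡⟨ sym ∑-holeCount ⟩
      ∑ (allFin u) holeCount               ≡⟨ ∑-cong (λ j → holeCount-uniform a j i) (allFin u) ⟩
      ∑ (allFin u) (λ _ → holeCount i)     ≡⟨ ∑-allFin-const u (holeCount i) ⟩
      u * holeCount i                      ∎

  [g∸1]*lam≡2*holeCount : 2 ≤ u → Fin g → (i : Fin u) → (g ∸ 1) * lam ≡ 2 * holeCount i
  [g∸1]*lam≡2*holeCount 2≤u a i =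
    *-cancelˡ-≡ _ _ (u ∸ 1) {{>-nonZero (m<n⇒0<n∸m 2≤u)}} (begin
      (u ∸ 1) * ((g ∸ 1) * lam)       ≡⟨ sym (coverCount-degree a i) ⟩
      2 * coverCount i                ≡⟨ cong (2 *_) (coverCount≡[u∸1]*holeCount a i) ⟩
      2 * ((u ∸ 1) * holeCount i)     ≡⟨ *-left-comm 2 (u ∸ 1) (holeCount i) ⟩
      (u ∸ 1) * (2 * holeCount i)     ∎)

theorem1p1 : (k u g lam : ℕ) → 2 ∣ k → k ≥ 4 → u ≥ 1 → g ≥ 1 → lam ≥ 1 →
    ARCS k u g lam →
    ((u ≥ 3 × g ≥ 2) × (k ∣ g * (u ∸ 1))) × (2 ∣ lam * (g ∸ 1))
theorem1p1 k u g lam _ k≥4 u≥1 g≥1 _ A =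
  (bounds , divides (length (PartialCkFactor.cycles F)) (factor-vertex-count F)) ,
  divides (holeCount A i) (begin
    lam * (g ∸ 1)      ≡⟨ *-comm lam (g ∸ 1) ⟩
    (g ∸ 1) * lam      ≡⟨ [g∸1]*lam≡2*holeCount A (≤-trans (n≤1+n 2) (proj₁ bounds)) (fromℕ< g≥1) i ⟩
    2 * holeCount A i  ≡⟨ *-comm 2 (holeCount A i) ⟩
    holeCount A i * 2  ∎)
  where
  F : PartialCkFactor k u g
  F = proj₁ (nonempty-∈ (ARCS.nonEmpty A))
  bounds : u ≥ 3 × g ≥ 2
  bounds = factor-bounds F (≤-trans (n≤1+n 2) (≤-trans (n≤1+n 3) k≥4))
  i : Fin u
  i = fromℕ< u≥1
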